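{- Let $S=(L,A,<)$ be an abstract numeration system, where $L$ is an infinite regular language over a totally ordered finite alphabet $(A,<)$. A set $E\subseteq\mathbb{N}$ is $S$-recognizable if and only if $\mathrm{rep}_S(E)$ is the language accepted by some $L$-automaton.
   Context: Words of $L$ are enumerated in increasing genealogical order ($x<y$ iff $|x|<|y|$, or $|x|=|y|$ and $x$ is lexicographically smaller than $y$); $\mathrm{rep}_S(n)$ denotes the $(n+1)$-th word of $L$ in this enumeration, giving a bijection $\mathbb{N}\to L$. A set $E\subseteq\mathbb{N}$ is $S$-recognizable if $\mathrm{rep}_S(E)$ is a regular language. A DFA is $\mathcal{M}=(Q,q_0,F,A,\delta)$ with a possibly partial transition function $\delta:Q\times A\to Q$. The canonical automaton of a regular language $L$ is its trim (accessible and coaccessible) minimal DFA $\mathcal{A}=(Q',q_0',F',A,\delta')$. A DFA $\mathcal{M}=(Q,q_0,F,A,\delta)$ is an $L$-automaton if there is an onto map $\Phi:Q\to Q'$ with $\Phi(q_0)=q_0'$, $\Phi(F)\subseteq F'$, and for all $q\in Q$, $a\in A$: $\Phi(\delta(q,a))=\delta'(\Phi(q),a)$, where $\delta(q,a)$ is defined if and only if $\delta'(\Phi(q),a)$ is defined. -}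

module Defs where

open import Data.Nat using (ℕ; _<_; _≤_)
open import Data.Fin as Fin using (Fin)
open import Data.Bool using (Bool; true)
open import Data.Maybe using (Maybe; just; nothing; _>>=_)
import Data.Maybe as Maybe
open import Data.List using (List; []; _∷_; length)
open import Data.List.Membership.Propositional using (_∈_; _∉_)
open import Data.List.Relation.Unary.Unique.Propositional using (Unique)
open import Data.List.Relation.Binary.Lex.Strict using (Lex-<)
open import Data.Product using (Σ; ∃; _×_)
open import Data.Sum using (_⊎_)
open import Function using (Surjective)
open import Function.Bundles using (_⇔_)
open import Relation.Binary.PropositionalEquality using (_≡_)

-- The totally ordered finite alphabet (A,<) is Fin k with its usual order.
Word : ℕ → Set
Word k = List (Fin k)

Language : ℕ → Set₁
Language k = Word k → Set

_<gen_ : ∀ {k} → Word k → Word k → Set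
u <gen w = length u < length w ⊎ (length u ≡ length w × Lex-< _≡_ Fin._<_ u w)

record DFA (k : ℕ) : Set where
  field
    states : ℕ
    init   : Fin states
    final  : Fin states → Bool
    δ      : Fin states → Fin k → Maybe (Fin states)

module _ {k : ℕ} (M : DFA k) where
  open DFA M

  run : Fin states → Word k → Maybe (Fin states)
  run q []      = just q
  run q (a ∷ w) = δ q a >>= λ q′ → run q′ w

  Acc : Word k → Set
  Acc w = Σ (Fin states) λ q → run init w ≡ just q × final q ≡ true

  Recognizes : Language k → Set
  Recognizes P = ∀ w → P w ⇔ Acc w

  Accessible : Fin states → Set
  Accessible q = ∃ λ w → run init w ≡ just q

  Coaccessible : Fin states → Set
  Coaccessible q = ∃ λ w → Σ (Fin states) λ q′ → run q w ≡ just q′ × final q′ ≡ true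

  Trim : Set
  Trim = ∀ q → Accessible q × Coaccessible q

Regular : ∀ {k} → Language k → Set
Regular {k} L = Σ (DFA k) λ M → Recognizes M L

Infinite : ∀ {k} → Language k → Set
Infinite {k} L = (ws : List (Word k)) → Σ (Word k) λ w → L w × w ∉ ws

Canonical : ∀ {k} → Language k → DFA k → Set
Canonical {k} L 𝒜 =
  Recognizes 𝒜 L × Trim 𝒜 ×
  ((M : DFA k) → Recognizes M L → DFA.states 𝒜 ≤ DFA.states M)

-- Index L w n : w has exactly n predecessors in L for the genealogical order,
-- i.e. (when w ∈ L) rep_S(n) = w.
Index : ∀ {k} → Language k → Word k → ℕ → Set
Index {k} L w n = Σ (List (Word k)) λ ws →
  length ws ≡ n × Unique ws × (∀ u → u ∈ ws ⇔ (L u × u <gen w))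

RepLang : ∀ {k} → Language k → (ℕ → Set) → Language k
RepLang L E w = L w × Σ ℕ λ n → E n × Index L w n

Recognizable : ∀ {k} → Language k → (ℕ → Set) → Set
Recognizable L E = Regular (RepLang L E)

-- M is an L-automaton relative to the canonical automaton 𝒜 of L.
-- Maybe.map Φ (δ q a) ≡ δ' (Φ q) a encodes both: definedness coincides and
-- Φ(δ(q,a)) = δ'(Φ(q),a).
IsLAutomaton : ∀ {k} → DFA k → DFA k → Set
IsLAutomaton 𝒜 M =
  Σ (Fin (DFA.states M) → Fin (DFA.states 𝒜)) λ Φ →
    Surjective _≡_ _≡_ Φ ×
    Φ (DFA.init M) ≡ DFA.init 𝒜 ×
    (∀ q → DFA.final M q ≡ true → DFA.final 𝒜 (Φ q) ≡ true) ×
    (∀ q a → Maybe.map Φ (DFA.δ M q a) ≡ DFA.δ 𝒜 (Φ q) a)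

-- If ℬ accepts rep_S(E), run ℬ, completed by a dead sink state, alongside the
-- canonical automaton 𝒜 of L, letting a transition exist exactly when 𝒜 has one.
-- This product accepts L ∩ rep_S(E) = rep_S(E), and the first projection is an
-- onto morphism to 𝒜, so it is an L-automaton. Conversely an L-automaton is a DFA.
module Submission where

open import Defs
open import Data.Nat using (ℕ; suc; _*_)
open import Data.Fin using (Fin; zero; suc; combine; remQuot)
open import Data.Fin.Properties using (remQuot-combine)
open import Data.Bool using (Bool; true; false; T; _∧_)
open import Data.Bool.Properties using (T-≡; T-∧)
open import Data.Maybe using (just; nothing; maybe′)
import Data.Maybe as Maybe
open import Data.Maybe.Properties using (map-∘; map-cong; map-id)
open import Data.List using ([]; _∷_)
open import Data.Product using (Σ; _×_; _,_; proj₁; proj₂)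
open import Data.Product.Function.NonDependent.Propositional using (_×-⇔_)
open import Function using (_∘_; id)
open import Function.Bundles using (_⇔_; mk⇔; module Equivalence)
import Function.Properties.Equivalence as ⇔
open import Relation.Binary.PropositionalEquality
  using (_≡_; refl; cong; cong₂; subst; module ≡-Reasoning)

open Equivalence using (to; from)

module _ {k : ℕ} (M : DFA k) where
  open DFA M

  accepts-from : Fin states → Word k → Bool
  accepts-from q w = maybe′ final false (run M q w)

  accepts : Word k → Bool
  accepts = accepts-from init

  Acc⇔accepts : ∀ w → Acc M w ⇔ T (accepts w)
  Acc⇔accepts w with run M init w
  ... | nothing = mk⇔ (λ { (_ , () , _) }) (λ ())
  ... | just q  = mk⇔ (λ { (_ , refl , q-final) → from T-≡ q-final })
                      (λ q-final → q , refl , to T-≡ q-final)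

  step⊥ : Fin (suc states) → Fin k → Fin (suc states)
  step⊥ zero    a = zero
  step⊥ (suc q) a = maybe′ suc zero (δ q a)

  run⊥ : Fin (suc states) → Word k → Fin (suc states)
  run⊥ q []      = q
  run⊥ q (a ∷ w) = run⊥ (step⊥ q a) w

  final⊥ : Fin (suc states) → Bool
  final⊥ zero    = false
  final⊥ (suc q) = final q

  run⊥-sink : ∀ w → run⊥ zero w ≡ zero
  run⊥-sink []      = refl
  run⊥-sink (a ∷ w) = run⊥-sink w

  final⊥-run⊥ : ∀ q w → final⊥ (run⊥ (suc q) w) ≡ accepts-from q w
  final⊥-run⊥ q []      = refl
  final⊥-run⊥ q (a ∷ w) with δ q a
  ... | nothing = cong final⊥ (run⊥-sink w)
  ... | just q′ = final⊥-run⊥ q′ w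

module Product {k : ℕ} (𝒜 ℬ : DFA k) where
  private
    module 𝒜 = DFA 𝒜
    module ℬ = DFA ℬ

  State : Set
  State = Fin (𝒜.states * suc ℬ.states)

  ⟨_,_⟩ : Fin 𝒜.states → Fin (suc ℬ.states) → State
  ⟨ p , q ⟩ = combine p q

  π₁ : State → Fin 𝒜.states
  π₁ x = proj₁ (remQuot {𝒜.states} (suc ℬ.states) x)

  π₂ : State → Fin (suc ℬ.states)
  π₂ x = proj₂ (remQuot {𝒜.states} (suc ℬ.states) x)

  π₁-⟨⟩ : ∀ {p q} → π₁ ⟨ p , q ⟩ ≡ p
  π₁-⟨⟩ {p} {q} = cong proj₁ (remQuot-combine p q)

  π₂-⟨⟩ : ∀ {p q} → π₂ ⟨ p , q ⟩ ≡ q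
  π₂-⟨⟩ {p} {q} = cong proj₂ (remQuot-combine p q)

  𝒜⊗ℬ : DFA k
  𝒜⊗ℬ = record
    { states = 𝒜.states * suc ℬ.states
    ; init   = ⟨ 𝒜.init , suc ℬ.init ⟩
    ; final  = λ x → 𝒜.final (π₁ x) ∧ final⊥ ℬ (π₂ x)
    ; δ      = λ x a → Maybe.map (λ p′ → ⟨ p′ , step⊥ ℬ (π₂ x) a ⟩) (𝒜.δ (π₁ x) a)
    }

  final-⟨⟩ : ∀ p q → DFA.final 𝒜⊗ℬ ⟨ p , q ⟩ ≡ 𝒜.final p ∧ final⊥ ℬ q
  final-⟨⟩ p q = cong₂ _∧_ (cong 𝒜.final π₁-⟨⟩) (cong (final⊥ ℬ) π₂-⟨⟩)

  run-⟨⟩ : ∀ p q w →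
           run 𝒜⊗ℬ ⟨ p , q ⟩ w ≡ Maybe.map (λ p′ → ⟨ p′ , run⊥ ℬ q w ⟩) (run 𝒜 p w)
  run-⟨⟩ p q []      = refl
  run-⟨⟩ p q (a ∷ w) rewrite π₁-⟨⟩ {p} {q} | π₂-⟨⟩ {p} {q} with 𝒜.δ p a
  ... | nothing = refl
  ... | just p′ = run-⟨⟩ p′ (step⊥ ℬ q a) w

  accepts-𝒜⊗ℬ : ∀ w → accepts 𝒜⊗ℬ w ≡ accepts 𝒜 w ∧ accepts ℬ w
  accepts-𝒜⊗ℬ w rewrite run-⟨⟩ 𝒜.init (suc ℬ.init) w with run 𝒜 𝒜.init w
  ... | nothing = refl
  ... | just p  = begin
    DFA.final 𝒜⊗ℬ ⟨ p , run⊥ ℬ (suc ℬ.init) w ⟩  ≡⟨ final-⟨⟩ p _ ⟩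
    𝒜.final p ∧ final⊥ ℬ (run⊥ ℬ (suc ℬ.init) w) ≡⟨ cong (𝒜.final p ∧_) (final⊥-run⊥ ℬ ℬ.init w) ⟩
    𝒜.final p ∧ accepts ℬ w                        ∎
    where open ≡-Reasoning

  Acc-𝒜⊗ℬ : ∀ w → Acc 𝒜⊗ℬ w ⇔ (Acc 𝒜 w × Acc ℬ w)
  Acc-𝒜⊗ℬ w =
    ⇔.trans (subst (λ b → Acc 𝒜⊗ℬ w ⇔ T b) (accepts-𝒜⊗ℬ w) (Acc⇔accepts 𝒜⊗ℬ w))
      (⇔.trans T-∧ (⇔.sym (Acc⇔accepts 𝒜 w ×-⇔ Acc⇔accepts ℬ w)))

  recognizes-∩ : ∀ {L P} → Recognizes 𝒜 L → Recognizes ℬ P →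
                 Recognizes 𝒜⊗ℬ (λ w → L w × P w)
  recognizes-∩ 𝒜-L ℬ-P w = ⇔.trans (𝒜-L w ×-⇔ ℬ-P w) (⇔.sym (Acc-𝒜⊗ℬ w))

  isLAutomaton : IsLAutomaton 𝒜 𝒜⊗ℬ
  isLAutomaton =
    π₁ ,
    (λ p → ⟨ p , zero ⟩ , λ { refl → π₁-⟨⟩ }) ,
    π₁-⟨⟩ ,
    (λ x x-final → to T-≡ (proj₁ (to T-∧ (from T-≡ x-final)))) ,
    π₁-δ
    where
    π₁-δ : ∀ x a → Maybe.map π₁ (DFA.δ 𝒜⊗ℬ x a) ≡ 𝒜.δ (π₁ x) a
    π₁-δ x a = begin
      Maybe.map π₁ (Maybe.map ⟨_, q ⟩ (𝒜.δ (π₁ x) a)) ≡⟨ map-∘ (𝒜.δ (π₁ x) a) ⟨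
      Maybe.map (π₁ ∘ ⟨_, q ⟩) (𝒜.δ (π₁ x) a)         ≡⟨ map-cong (λ _ → π₁-⟨⟩) (𝒜.δ (π₁ x) a) ⟩
      Maybe.map id (𝒜.δ (π₁ x) a)                     ≡⟨ map-id (𝒜.δ (π₁ x) a) ⟩
      𝒜.δ (π₁ x) a                                    ∎
      where
      open ≡-Reasoning
      q = step⊥ ℬ (π₂ x) a

open Product using (𝒜⊗ℬ; recognizes-∩; isLAutomaton)

lemma5 : (k : ℕ) (L : Language k) → Regular L → Infinite L →
         (𝒜 : DFA k) → Canonical L 𝒜 → (E : ℕ → Set) →
         Recognizable L E ⇔ Σ (DFA k) (λ M → IsLAutomaton 𝒜 M × Recognizes M (RepLang L E))
lemma5 k L _ _ 𝒜 (𝒜-L , _ , _) E = mk⇔ product-automaton forget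
  where
  rep⇔L∩rep : ∀ w → RepLang L E w ⇔ (L w × RepLang L E w)
  rep⇔L∩rep w = mk⇔ (λ r → proj₁ r , r) proj₂

  product-automaton : Recognizable L E →
                      Σ (DFA k) (λ M → IsLAutomaton 𝒜 M × Recognizes M (RepLang L E))
  product-automaton (ℬ , ℬ-rep) =
    𝒜⊗ℬ 𝒜 ℬ , isLAutomaton 𝒜 ℬ ,
    λ w → ⇔.trans (rep⇔L∩rep w) (recognizes-∩ 𝒜 ℬ 𝒜-L ℬ-rep w)

  forget : Σ (DFA k) (λ M → IsLAutomaton 𝒜 M × Recognizes M (RepLang L E)) → Recognizable L E
  forget (M , _ , M-rep) = M , M-rep
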